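{- Let $\mathbb{K}\in\{\mathbb{R},\mathbb{C}\}$ and $n\ge1$. Let $\mathfrak{l}=\mathbb{K}^{n\times n}\cdot A$ be a minimal left ideal of the matrix ring $\mathbb{K}^{n\times n}$ with generating element $0\neq A\in\mathbb{K}^{n\times n}$, and let $0\neq B=[b_{ij}]\in\mathbb{K}^{n\times n}$. Let $a\neq0$ be a row of $A$, and let $\Lambda$ be a parametric form of the solution set of the homogeneous linear system $\sum_{j=1}^n b_{ij}\lambda_j=0$, $i=1,\dots,n$, in the unknowns $\lambda_1,\dots,\lambda_n\in\mathbb{K}$; that is, a set $F\subseteq\{1,\dots,n\}$ of indices is chosen such that the unknowns $\lambda_j$, $j\in F$, are free parameters and every other unknown $\lambda_i$, $i\notin F$, is uniquely expressed as a linear function of these parameters, every choice of parameters giving a solution and every solution arising this way. Then $\{B\cdot C_{i,a}\mid i\in\{1,\dots,n\}\setminus F\}$ (i.e. $i$ ranges over the indices for which $\lambda_i$ is not a parameter in $\Lambda$) is a basis of the $\mathbb{K}$-vector space $B\cdot\mathfrak{l}=B\cdot\mathbb{K}^{n\times n}\cdot A$.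
   Context: For a row vector $a\in\mathbb{K}^n$ and $1\le i\le n$, $C_{i,a}\in\mathbb{K}^{n\times n}$ denotes the matrix whose $i$-th row equals $a$ and all of whose other rows are zero. -}

module Defs where

open import Level using (Level; _⊔_)
open import Algebra.Bundles using (CommutativeRing)
open import Data.Nat using (ℕ; zero; suc)
open import Data.Fin using (Fin; zero; suc; _≟_)
open import Data.Fin.Subset using (Subset; _∈_; _∉_)
open import Data.Vec using (lookup)
open import Data.Bool using (true; false)
open import Data.Product using (Σ; ∃; _×_; _,_)
open import Relation.Nullary using (¬_; yes; no)

record Field (c ℓ : Level) : Set (Level.suc (c ⊔ ℓ)) where
  field
    commutativeRing : CommutativeRing c ℓ
  open CommutativeRing commutativeRing public
  field
    0≉1     : ¬ (0# ≈ 1#)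
    inverse : ∀ x → ¬ (x ≈ 0#) → ∃ λ y → x * y ≈ 1#

module LinAlg {c ℓ : Level} (K : Field c ℓ) where
  open Field K public using (Carrier; _≈_; _+_; _*_; -_; 0#; 1#)

  ∑ : ∀ {n} → (Fin n → Carrier) → Carrier
  ∑ {zero}  f = 0#
  ∑ {suc n} f = f zero + ∑ (λ i → f (suc i))

  Vector : ℕ → Set c
  Vector n = Fin n → Carrier

  Mat : ℕ → Set c
  Mat n = Fin n → Fin n → Carrier

  _≈ᵥ_ : ∀ {n} → Vector n → Vector n → Set ℓ
  u ≈ᵥ v = ∀ j → u j ≈ v j

  _≈ₘ_ : ∀ {n} → Mat n → Mat n → Set ℓ
  X ≈ₘ Y = ∀ i j → X i j ≈ Y i j

  0ₘ : ∀ {n} → Mat n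
  0ₘ i j = 0#

  _+ₘ_ : ∀ {n} → Mat n → Mat n → Mat n
  (X +ₘ Y) i j = X i j + Y i j

  _·ₘ_ : ∀ {n} → Carrier → Mat n → Mat n
  (x ·ₘ Y) i j = x * Y i j

  _*ₘ_ : ∀ {n} → Mat n → Mat n → Mat n
  (X *ₘ Y) i j = ∑ (λ k → X i k * Y k j)

  C : ∀ {n} → Fin n → Vector n → Mat n
  C i a r s with r ≟ i
  ... | yes _ = a s
  ... | no  _ = 0#

  MatSet : ℕ → Set (Level.suc (c ⊔ ℓ))
  MatSet n = Mat n → Set (c ⊔ ℓ)

  record IsLeftIdeal {n} (J : MatSet n) : Set (c ⊔ ℓ) where
    field
      respects : ∀ {X Y} → X ≈ₘ Y → J X → J Y
      zero∈    : J 0ₘ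
      +-closed : ∀ {X Y} → J X → J Y → J (X +ₘ Y)
      *-closed : ∀ (M : Mat n) {X} → J X → J (M *ₘ X)

  Nonzero : ∀ {n} → MatSet n → Set (c ⊔ ℓ)
  Nonzero J = ∃ λ X → J X × ¬ (X ≈ₘ 0ₘ)

  record IsMinimalLeftIdeal {n} (L : MatSet n) : Set (Level.suc (c ⊔ ℓ)) where
    field
      isLeftIdeal : IsLeftIdeal L
      nonzero     : Nonzero L
      minimal     : ∀ (J : MatSet n) → IsLeftIdeal J → Nonzero J →
                    (∀ X → J X → L X) → ∀ X → L X → J X

  principalLeft : ∀ {n} → Mat n → MatSet n
  principalLeft A X = ∃ λ M → X ≈ₘ (M *ₘ A)

  leftRight : ∀ {n} → Mat n → Mat n → MatSet n
  leftRight B A X = ∃ λ M → X ≈ₘ ((B *ₘ M) *ₘ A)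

  IsSolution : ∀ {n} → Mat n → Vector n → Set ℓ
  IsSolution B λ' = ∀ i → ∑ (λ j → B i j * λ' j) ≈ 0#

  ∑∈ : ∀ {n} → Subset n → (Fin n → Carrier) → Carrier
  ∑∈ F f = ∑ (λ j → sel (lookup F j) j)
    where
      sel : _ → _ → Carrier
      sel true  j = f j
      sel false j = 0#

  ∑∉ : ∀ {n} → Subset n → (Fin n → Carrier) → Carrier
  ∑∉ F f = ∑ (λ i → sel (lookup F i) i)
    where
      sel : _ → _ → Carrier
      sel true  i = 0#
      sel false i = f i

  ∑ₘ∉ : ∀ {n} → Subset n → (Fin n → Mat n) → Mat n
  ∑ₘ∉ F f r s = ∑∉ F (λ i → f i r s)

  -- A parametric form Λ of the solution set: the unknowns λ_j (j ∈ F) are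
  -- free parameters, and each λ_i (i ∉ F) is the linear function
  -- ∑_{j ∈ F} coef i j · λ_j of the parameters; every choice of parameters
  -- gives a solution and every solution arises this way.
  param : ∀ {n} → Subset n → (Fin n → Fin n → Carrier) → Vector n → Vector n
  param F coef p i with lookup F i
  ... | true  = p i
  ... | false = ∑∈ F (λ j → coef i j * p j)

  record ParametricForm {n} (B : Mat n) (F : Subset n) : Set (c ⊔ ℓ) where
    field
      coef     : Fin n → Fin n → Carrier
      sound    : ∀ (p : Vector n) → IsSolution B (param F coef p)
      complete : ∀ (λ' : Vector n) → IsSolution B λ' →
                 ∃ λ (p : Vector n) → λ' ≈ᵥ param F coef p

  record IsBasis∉ {n} (V : MatSet n) (F : Subset n) (v : Fin n → Mat n)
                  : Set (c ⊔ ℓ) where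
    field
      members     : ∀ i → i ∉ F → V (v i)
      spanning    : ∀ X → V X →
                    ∃ λ (μ : Vector n) → X ≈ₘ ∑ₘ∉ F (λ i → μ i ·ₘ v i)
      independent : ∀ (μ : Vector n) → ∑ₘ∉ F (λ i → μ i ·ₘ v i) ≈ₘ 0ₘ →
                    ∀ i → i ∉ F → μ i ≈ 0#

-- Write a = A k and outer u w = u wᵀ.  The element outer a a = (outer a e_k)·A of 𝕂ⁿˣⁿ·A is
-- nonzero, so by minimality A = N·(outer a a) = outer ρ a with ρ = N a: every row of A is a
-- multiple of a.  Since ρ k ≉ 0, the functional "row k of N" does not vanish on a, which lets
-- one cancel a (y a = 0 ⇒ y = 0; constructively a ≉ 0 alone would not give this).  Hence
-- B·𝕂ⁿˣⁿ·A = { outer (B x) a } and B·C_{i,a} = outer (B e_i) a, and the claim becomes that the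
-- columns of B outside F are a basis of its column space: they span by soundness of the
-- parametric form, and they are independent by its completeness.
module Submission where

open import Defs
open import Level using (Level)
open import Data.Nat using (ℕ; _≤_)
open import Data.Fin using (Fin)
open import Data.Fin.Subset using (Subset)
open import Relation.Nullary using (¬_)

import Algebra.Properties.CommutativeSemigroup as CommutativeSemigroupProperties
import Algebra.Properties.Group as GroupProperties
import Algebra.Properties.Semiring.Sum as SemiringSum
open import Data.Bool using (true; false)
open import Data.Fin using (zero; suc; _≟_; punchIn)
open import Data.Fin.Properties using (punchInᵢ≢i; sequence)
open import Data.Fin.Subset using (_∈_; _∉_)
open import Data.Nat using (zero; suc)
open import Data.Product using (∃; _,_; proj₁; proj₂)
open import Data.Vec using (lookup)
open import Data.Vec.Properties using ([]=⇒lookup; lookup⇒[]=)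
import Data.Vec.Functional.Relation.Binary.Equality.Setoid as VecEquality
open import Effect.Monad using (RawMonad)
open import Function using (_∘_)
open import Relation.Binary.Bundles using (Setoid)
open import Relation.Binary.PropositionalEquality as ≡ using (_≡_; _≢_)
import Relation.Binary.Reasoning.Setoid as SetoidReasoning
open import Relation.Nullary using (yes; no; contradiction)
open import Relation.Nullary.Negation using (¬¬-Monad)

module _ {c ℓ : Level} (K : Field c ℓ) where
  open LinAlg K
  open Field K using (setoid; refl; sym; trans; reflexive; +-cong; +-congˡ; *-congˡ; *-congʳ;
    *-assoc; *-comm; +-identityʳ; *-identityˡ; *-identityʳ; zeroˡ; zeroʳ; distribˡ; distribʳ;
    -‿inverseʳ; _-_; inverse; semiring; +-group; *-commutativeSemigroup)
  open SemiringSum semiring using (sum; sum-cong-≋; sum-cong-≗; sum-remove; sum-replicate-zero;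
    *-distribˡ-sum; *-distribʳ-sum) renaming (∑-distrib-+ to sum-distrib-+; ∑-comm to sum-comm)
  open GroupProperties +-group using (//-rightDividesˡ)
  open CommutativeSemigroupProperties *-commutativeSemigroup using (x∙yz≈y∙xz)

  module ≈-Reasoning = SetoidReasoning setoid

  ≈ₘ-setoid : ℕ → Setoid c ℓ
  ≈ₘ-setoid n = VecEquality.≋-setoid (VecEquality.≋-setoid setoid n) n

  module ≈ₘ-Reasoning {n : ℕ} = SetoidReasoning (≈ₘ-setoid n)

  ≈ₘ-sym : ∀ {n} {X Y : Mat n} → X ≈ₘ Y → Y ≈ₘ X
  ≈ₘ-sym {n} = Setoid.sym (≈ₘ-setoid n)

  ≈ₘ-trans : ∀ {n} {X Y Z : Mat n} → X ≈ₘ Y → Y ≈ₘ Z → X ≈ₘ Z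
  ≈ₘ-trans {n} = Setoid.trans (≈ₘ-setoid n)

  ∑≡sum : ∀ {n} (f : Vector n) → ∑ f ≡ sum f
  ∑≡sum {zero}  f = ≡.refl
  ∑≡sum {suc n} f = ≡.cong (f zero +_) (∑≡sum (f ∘ suc))

  ∑-cong : ∀ {n} {f g : Vector n} → f ≈ᵥ g → ∑ f ≈ ∑ g
  ∑-cong {f = f} {g} f≈g = begin
    ∑ f   ≡⟨ ∑≡sum f ⟩
    sum f ≈⟨ sum-cong-≋ f≈g ⟩
    sum g ≡⟨ ∑≡sum g ⟨
    ∑ g   ∎
    where open ≈-Reasoning

  ∑-zero : ∀ {n} {f : Vector n} → f ≈ᵥ (λ _ → 0#) → ∑ f ≈ 0#
  ∑-zero {n} f≈0 =
    trans (∑-cong f≈0) (trans (reflexive (∑≡sum {n} (λ _ → 0#))) (sum-replicate-zero n))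

  ∑-distrib-+ : ∀ {n} (f g : Vector n) → ∑ (λ i → f i + g i) ≈ ∑ f + ∑ g
  ∑-distrib-+ f g = begin
    ∑ (λ i → f i + g i)   ≡⟨ ∑≡sum (λ i → f i + g i) ⟩
    sum (λ i → f i + g i) ≈⟨ sum-distrib-+ f g ⟩
    sum f + sum g         ≡⟨ ≡.cong₂ _+_ (∑≡sum f) (∑≡sum g) ⟨
    ∑ f + ∑ g             ∎
    where open ≈-Reasoning

  *-distribˡ-∑ : ∀ {n} x (f : Vector n) → x * ∑ f ≈ ∑ (λ i → x * f i)
  *-distribˡ-∑ x f = begin
    x * ∑ f             ≡⟨ ≡.cong (x *_) (∑≡sum f) ⟩
    x * sum f           ≈⟨ *-distribˡ-sum x f ⟩
    sum (λ i → x * f i) ≡⟨ ∑≡sum (λ i → x * f i) ⟨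
    ∑ (λ i → x * f i)   ∎
    where open ≈-Reasoning

  *-distribʳ-∑ : ∀ {n} x (f : Vector n) → ∑ f * x ≈ ∑ (λ i → f i * x)
  *-distribʳ-∑ x f = begin
    ∑ f * x             ≡⟨ ≡.cong (_* x) (∑≡sum f) ⟩
    sum f * x           ≈⟨ *-distribʳ-sum x f ⟩
    sum (λ i → f i * x) ≡⟨ ∑≡sum (λ i → f i * x) ⟨
    ∑ (λ i → f i * x)   ∎
    where open ≈-Reasoning

  ∑-comm : ∀ {m n} (f : Fin m → Fin n → Carrier) →
           ∑ (λ i → ∑ (f i)) ≈ ∑ (λ j → ∑ (λ i → f i j))
  ∑-comm f = begin
    ∑ (λ i → ∑ (f i))               ≡⟨ ∑∑≡sum-sum f ⟩
    sum (λ i → sum (f i))           ≈⟨ sum-comm f ⟩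
    sum (λ j → sum (λ i → f i j))   ≡⟨ ∑∑≡sum-sum (λ j i → f i j) ⟨
    ∑ (λ j → ∑ (λ i → f i j))       ∎
    where
      open ≈-Reasoning
      ∑∑≡sum-sum : ∀ {m n} (g : Fin m → Fin n → Carrier) →
                   ∑ (λ i → ∑ (g i)) ≡ sum (λ i → sum (g i))
      ∑∑≡sum-sum g = ≡.trans (∑≡sum (λ i → ∑ (g i))) (sum-cong-≗ (λ i → ∑≡sum (g i)))

  ∑-supported : ∀ {n} {f : Vector n} (k : Fin n) → (∀ t → t ≢ k → f t ≈ 0#) → ∑ f ≈ f k
  ∑-supported {suc n} {f} k f≈0 = begin
    ∑ f                        ≡⟨ ∑≡sum f ⟩
    sum f                      ≈⟨ sum-remove {i = k} f ⟩
    f k + sum (f ∘ punchIn k)  ≈⟨ +-congˡ (trans (sum-cong-≋ (λ j → f≈0 (punchIn k j) (punchInᵢ≢i k j)))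
                                                  (sum-replicate-zero n)) ⟩
    f k + 0#                   ≈⟨ +-identityʳ (f k) ⟩
    f k                        ∎
    where open ≈-Reasoning

  x*y≈0⇒x≈0 : ∀ {x y} → ¬ (y ≈ 0#) → x * y ≈ 0# → x ≈ 0#
  x*y≈0⇒x≈0 {x} {y} y≉0 xy≈0 with inverse y y≉0
  ... | y⁻¹ , yy⁻¹≈1 = begin
    x             ≈⟨ *-identityʳ x ⟨
    x * 1#        ≈⟨ *-congˡ yy⁻¹≈1 ⟨
    x * (y * y⁻¹) ≈⟨ *-assoc x y y⁻¹ ⟨
    x * y * y⁻¹   ≈⟨ *-congʳ xy≈0 ⟩
    0# * y⁻¹      ≈⟨ zeroˡ y⁻¹ ⟩
    0#            ∎
    where open ≈-Reasoning

  x*x≈0⇒¬¬x≈0 : ∀ {x} → x * x ≈ 0# → ¬ ¬ (x ≈ 0#)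
  x*x≈0⇒¬¬x≈0 xx≈0 x≉0 = x≉0 (x*y≈0⇒x≈0 x≉0 xx≈0)

  x*u≈0⇒x≈0 : ∀ {n x} {u : Vector n} (φ : Vector n) → ¬ (∑ (λ t → φ t * u t) ≈ 0#) →
              (∀ t → x * u t ≈ 0#) → x ≈ 0#
  x*u≈0⇒x≈0 {x = x} {u} φ φu≉0 xu≈0 = x*y≈0⇒x≈0 φu≉0 (begin
    x * ∑ (λ t → φ t * u t)   ≈⟨ *-distribˡ-∑ x (λ t → φ t * u t) ⟩
    ∑ (λ t → x * (φ t * u t)) ≈⟨ ∑-zero (λ t → trans (x∙yz≈y∙xz x (φ t) (u t))
                                                     (trans (*-congˡ (xu≈0 t)) (zeroʳ (φ t)))) ⟩
    0#                        ∎)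
    where open ≈-Reasoning

  e : ∀ {n} → Fin n → Vector n
  e k t with t ≟ k
  ... | yes _ = 1#
  ... | no  _ = 0#

  ∑-e* : ∀ {n} (k : Fin n) (f : Vector n) → ∑ (λ t → e k t * f t) ≈ f k
  ∑-e* k f = trans (∑-supported k e*f≈0) e*f≈f
    where
      e*f≈0 : ∀ t → t ≢ k → e k t * f t ≈ 0#
      e*f≈0 t t≢k with t ≟ k
      ... | yes t≡k = contradiction t≡k t≢k
      ... | no  _   = zeroˡ (f t)
      e*f≈f : e k k * f k ≈ f k
      e*f≈f with k ≟ k
      ... | yes _   = *-identityˡ (f k)
      ... | no  k≢k = contradiction ≡.refl k≢k

  outer : ∀ {n} → Vector n → Vector n → Mat n
  outer u w r s = u r * w s

  outer-congˡ : ∀ {n} {u u′ : Vector n} (w : Vector n) → u ≈ᵥ u′ → outer u w ≈ₘ outer u′ w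
  outer-congˡ w u≈u′ r s = *-congʳ (u≈u′ r)

  outer-self≉0 : ∀ {n} {u : Vector n} → ¬ (u ≈ᵥ (λ _ → 0#)) → ¬ (outer u u ≈ₘ 0ₘ)
  outer-self≉0 u≉0 uu≈0 =
    -- each u j is only known to be ¬¬-zero, which is still enough to contradict u≉0
    sequence (RawMonad.rawApplicative ¬¬-Monad) (λ j → x*x≈0⇒¬¬x≈0 (uu≈0 j j)) u≉0

  C≈outer-e : ∀ {n} (i : Fin n) (u : Vector n) → C i u ≈ₘ outer (e i) u
  C≈outer-e i u r s with r ≟ i
  ... | yes _ = sym (*-identityˡ (u s))
  ... | no  _ = sym (zeroˡ (u s))

  1ₘ : ∀ {n} → Mat n
  1ₘ r = e r

  _*ᵥ_ : ∀ {n} → Mat n → Vector n → Vector n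
  (X *ᵥ u) r = ∑ (λ t → X r t * u t)

  *ᵥ-cong : ∀ {n} (X : Mat n) {u w : Vector n} → u ≈ᵥ w → (X *ᵥ u) ≈ᵥ (X *ᵥ w)
  *ᵥ-cong X u≈w r = ∑-cong (λ t → *-congˡ (u≈w t))

  *ᵥ-distrib-+ : ∀ {n} (X : Mat n) (u w : Vector n) →
                 (X *ᵥ (λ t → u t + w t)) ≈ᵥ (λ r → (X *ᵥ u) r + (X *ᵥ w) r)
  *ᵥ-distrib-+ X u w r = trans (∑-cong (λ t → distribˡ (X r t) (u t) (w t)))
                               (∑-distrib-+ (λ t → X r t * u t) (λ t → X r t * w t))

  *ᵥ-e : ∀ {n} (X : Mat n) (i : Fin n) → (X *ᵥ e i) ≈ᵥ (λ r → X r i)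
  *ᵥ-e X i r = trans (∑-cong (λ t → *-comm (X r t) (e i t))) (∑-e* i (X r))

  *ₘ-congˡ : ∀ {n} (X : Mat n) {Y Y′ : Mat n} → Y ≈ₘ Y′ → (X *ₘ Y) ≈ₘ (X *ₘ Y′)
  *ₘ-congˡ X Y≈Y′ r s = ∑-cong (λ t → *-congˡ (Y≈Y′ t s))

  *ₘ-assoc : ∀ {n} (X Y Z : Mat n) → ((X *ₘ Y) *ₘ Z) ≈ₘ (X *ₘ (Y *ₘ Z))
  *ₘ-assoc X Y Z r s = begin
    ∑ (λ t → ∑ (λ u → X r u * Y u t) * Z t s)
      ≈⟨ ∑-cong (λ t → *-distribʳ-∑ (Z t s) (λ u → X r u * Y u t)) ⟩
    ∑ (λ t → ∑ (λ u → X r u * Y u t * Z t s))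
      ≈⟨ ∑-comm (λ t u → X r u * Y u t * Z t s) ⟩
    ∑ (λ u → ∑ (λ t → X r u * Y u t * Z t s))
      ≈⟨ ∑-cong (λ u → ∑-cong (λ t → *-assoc (X r u) (Y u t) (Z t s))) ⟩
    ∑ (λ u → ∑ (λ t → X r u * (Y u t * Z t s)))
      ≈⟨ ∑-cong (λ u → *-distribˡ-∑ (X r u) (λ t → Y u t * Z t s)) ⟨
    ∑ (λ u → X r u * ∑ (λ t → Y u t * Z t s))
      ∎
    where open ≈-Reasoning

  *ₘ-distribʳ-+ₘ : ∀ {n} (X Y Z : Mat n) → ((X +ₘ Y) *ₘ Z) ≈ₘ ((X *ₘ Z) +ₘ (Y *ₘ Z))
  *ₘ-distribʳ-+ₘ X Y Z r s = trans (∑-cong (λ t → distribʳ (Z t s) (X r t) (Y r t)))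
                                   (∑-distrib-+ (λ t → X r t * Z t s) (λ t → Y r t * Z t s))

  *ₘ-zeroˡ : ∀ {n} (X : Mat n) → (0ₘ *ₘ X) ≈ₘ 0ₘ
  *ₘ-zeroˡ X r s = ∑-zero (λ t → zeroˡ (X t s))

  *ₘ-identityˡ : ∀ {n} (X : Mat n) → (1ₘ *ₘ X) ≈ₘ X
  *ₘ-identityˡ X r s = ∑-e* r (λ t → X t s)

  *ₘ-outer : ∀ {n} (X : Mat n) (u w : Vector n) → (X *ₘ outer u w) ≈ₘ outer (X *ᵥ u) w
  *ₘ-outer X u w r s = begin
    ∑ (λ t → X r t * (u t * w s)) ≈⟨ ∑-cong (λ t → *-assoc (X r t) (u t) (w s)) ⟨
    ∑ (λ t → X r t * u t * w s)   ≈⟨ *-distribʳ-∑ (w s) (λ t → X r t * u t) ⟨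
    (X *ᵥ u) r * w s              ∎
    where open ≈-Reasoning

  outer-e-*ₘ : ∀ {n} (u : Vector n) (k : Fin n) (Y : Mat n) → (outer u (e k) *ₘ Y) ≈ₘ outer u (Y k)
  outer-e-*ₘ u k Y r s = begin
    ∑ (λ t → u r * e k t * Y t s)   ≈⟨ ∑-cong (λ t → *-assoc (u r) (e k t) (Y t s)) ⟩
    ∑ (λ t → u r * (e k t * Y t s)) ≈⟨ *-distribˡ-∑ (u r) (λ t → e k t * Y t s) ⟨
    u r * ∑ (λ t → e k t * Y t s)   ≈⟨ *-congˡ (∑-e* k (λ t → Y t s)) ⟩
    u r * Y k s                     ∎
    where open ≈-Reasoning

  principalLeft-isLeftIdeal : ∀ {n} (A : Mat n) → IsLeftIdeal (principalLeft A)
  principalLeft-isLeftIdeal A = record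
    { respects = λ { X≈Y (M , X≈MA) → M , ≈ₘ-trans (≈ₘ-sym X≈Y) X≈MA }
    ; zero∈    = 0ₘ , ≈ₘ-sym (*ₘ-zeroˡ A)
    ; +-closed = λ { (M , X≈MA) (N , Y≈NA) →
        M +ₘ N , ≈ₘ-trans (λ r s → +-cong (X≈MA r s) (Y≈NA r s)) (≈ₘ-sym (*ₘ-distribʳ-+ₘ M N A)) }
    ; *-closed = λ { M′ (M , X≈MA) →
        M′ *ₘ M , ≈ₘ-trans (*ₘ-congˡ M′ X≈MA) (≈ₘ-sym (*ₘ-assoc M′ M A)) }
    }

  principalLeft-refl : ∀ {n} (A : Mat n) → principalLeft A A
  principalLeft-refl A = 1ₘ , ≈ₘ-sym (*ₘ-identityˡ A)

  principalLeft-⊆ : ∀ {n} {A X : Mat n} → principalLeft A X →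
                    ∀ Y → principalLeft X Y → principalLeft A Y
  principalLeft-⊆ {A = A} X∈𝕂A Y (M , Y≈MX) = respects (≈ₘ-sym Y≈MX) (*-closed M X∈𝕂A)
    where open IsLeftIdeal (principalLeft-isLeftIdeal A)

  minimal⇒generated-by-nonzero : ∀ {n} {A X : Mat n} → IsMinimalLeftIdeal (principalLeft A) →
                                 principalLeft A X → ¬ (X ≈ₘ 0ₘ) → principalLeft X A
  minimal⇒generated-by-nonzero {A = A} {X} 𝕂A-minimal X∈𝕂A X≉0 =
    minimal (principalLeft X) (principalLeft-isLeftIdeal X) (X , principalLeft-refl X , X≉0)
            (principalLeft-⊆ X∈𝕂A) A (principalLeft-refl A)
    where open IsMinimalLeftIdeal 𝕂A-minimal

  zeroOn : ∀ {n} → Subset n → Vector n → Vector n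
  zeroOn F u i with lookup F i
  ... | true  = 0#
  ... | false = u i

  zeroOn-∉ : ∀ {n} {F : Subset n} {i} (u : Vector n) → i ∉ F → zeroOn F u i ≡ u i
  zeroOn-∉ {F = F} {i} u i∉F with lookup F i in F[i]
  ... | true  = contradiction (lookup⇒[]= i F F[i]) i∉F
  ... | false = ≡.refl

  zeroOn-∈ : ∀ {n} {F : Subset n} {i} (u : Vector n) → i ∈ F → zeroOn F u i ≡ 0#
  zeroOn-∈ {F = F} {i} u i∈F rewrite []=⇒lookup i∈F = ≡.refl

  zeroOn-vanishing : ∀ {n} {F : Subset n} {u : Vector n} →
                     (∀ j → j ∈ F → u j ≈ 0#) → zeroOn F u ≈ᵥ u
  zeroOn-vanishing {F = F} u≈0 i with lookup F i in F[i]
  ... | true  = sym (u≈0 i (lookup⇒[]= i F F[i]))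
  ... | false = refl

  param-∈ : ∀ {n} {F : Subset n} {j} coef (p : Vector n) → j ∈ F → param F coef p j ≡ p j
  param-∈ {F = F} {j} coef p j∈F rewrite []=⇒lookup j∈F = ≡.refl

  -- The summands of ∑∉ and ∑∈ are where-bound functions, so below they are left to unification.
  mutual
    ∑∉-* : ∀ {n} (F : Subset n) (μ g : Vector n) →
           ∑∉ F (λ i → μ i * g i) ≈ ∑ (λ i → zeroOn F μ i * g i)
    ∑∉-* F μ g = ∑-cong (∑∉-*-summands F μ g)

    ∑∉-*-summands : ∀ {n} (F : Subset n) (μ g : Vector n) i → _ ≈ zeroOn F μ i * g i
    ∑∉-*-summands F μ g i with lookup F i
    ... | true  = sym (zeroˡ (g i))
    ... | false = refl

  mutual
    ∑∈-zero : ∀ {n} (F : Subset n) {f : Vector n} → (∀ j → j ∈ F → f j ≈ 0#) → ∑∈ F f ≈ 0#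
    ∑∈-zero F f≈0 = ∑-zero (∑∈-zero-summands F f≈0)

    ∑∈-zero-summands : ∀ {n} (F : Subset n) {f : Vector n} →
                       (∀ j → j ∈ F → f j ≈ 0#) → ∀ j → _ ≈ 0#
    ∑∈-zero-summands F f≈0 j with lookup F j in F[j]
    ... | true  = f≈0 j (lookup⇒[]= j F F[j])
    ... | false = refl

  param-zero : ∀ {n} (F : Subset n) coef {p : Vector n} →
               (∀ j → j ∈ F → p j ≈ 0#) → param F coef p ≈ᵥ (λ _ → 0#)
  param-zero F coef p≈0 i with lookup F i in F[i]
  ... | true  = p≈0 i (lookup⇒[]= i F F[i])
  ... | false = ∑∈-zero F (λ j j∈F → trans (*-congˡ (p≈0 j j∈F)) (zeroʳ (coef i j)))

  module _ {n} {B : Mat n} {F : Subset n} (Λ : ParametricForm B F) where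
    open ParametricForm Λ

    solution-vanishing-on-F⇒zero : ∀ {u : Vector n} → IsSolution B u →
                                   (∀ j → j ∈ F → u j ≈ 0#) → u ≈ᵥ (λ _ → 0#)
    solution-vanishing-on-F⇒zero {u} sol u≈0 with complete u sol
    ... | p , u≈param = λ i → trans (u≈param i) (param-zero F coef p≈0 i)
      where
        p≈0 : ∀ j → j ∈ F → p j ≈ 0#
        p≈0 j j∈F = trans (reflexive (≡.sym (param-∈ coef p j∈F)))
                          (trans (sym (u≈param j)) (u≈0 j j∈F))

    columns∉-span : ∀ (x : Vector n) → ∃ λ (μ : Vector n) → (B *ᵥ x) ≈ᵥ (B *ᵥ zeroOn F μ)
    columns∉-span x = μ , λ r → begin
      (B *ᵥ x) r                  ≈⟨ *ᵥ-cong B x≈μ+y r ⟩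
      (B *ᵥ (λ t → μ t + y t)) r  ≈⟨ *ᵥ-distrib-+ B μ y r ⟩
      (B *ᵥ μ) r + (B *ᵥ y) r     ≈⟨ +-congˡ (sound x r) ⟩
      (B *ᵥ μ) r + 0#             ≈⟨ +-identityʳ _ ⟩
      (B *ᵥ μ) r                  ≈⟨ *ᵥ-cong B (zeroOn-vanishing μ≈0) r ⟨
      (B *ᵥ zeroOn F μ) r         ∎
      where
        open ≈-Reasoning
        y : Vector n
        y = param F coef x
        μ : Vector n
        μ t = x t - y t
        x≈μ+y : x ≈ᵥ (λ t → μ t + y t)
        x≈μ+y t = sym (//-rightDividesˡ (y t) (x t))
        μ≈0 : ∀ j → j ∈ F → μ j ≈ 0#
        μ≈0 j j∈F = trans (reflexive (≡.cong (λ z → x j - z) (param-∈ coef x j∈F)))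
                          (-‿inverseʳ (x j))

  module RankOne {n} {A : Mat n} (𝕂A-minimal : IsMinimalLeftIdeal (principalLeft A))
                 (k : Fin n) (a≉0 : ¬ (A k ≈ᵥ (λ _ → 0#))) where
    a : Vector n
    a = A k

    A∈𝕂[outer-a-a] : principalLeft (outer a a) A
    A∈𝕂[outer-a-a] = minimal⇒generated-by-nonzero 𝕂A-minimal
      (outer a (e k) , ≈ₘ-sym (outer-e-*ₘ a k A)) (outer-self≉0 a≉0)

    N : Mat n
    N = proj₁ A∈𝕂[outer-a-a]

    ρ : Vector n
    ρ = N *ᵥ a

    A≈outer-ρ-a : A ≈ₘ outer ρ a
    A≈outer-ρ-a = ≈ₘ-trans (proj₂ A∈𝕂[outer-a-a]) (*ₘ-outer N a a)

    ρk≉0 : ¬ (ρ k ≈ 0#)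
    ρk≉0 ρk≈0 = a≉0 (λ s → trans (A≈outer-ρ-a k s) (trans (*-congʳ ρk≈0) (zeroˡ (a s))))

    cancel-a : ∀ {x} → (∀ s → x * a s ≈ 0#) → x ≈ 0#
    cancel-a = x*u≈0⇒x≈0 (N k) ρk≉0

  module Basis {n} {A : Mat n} (𝕂A-minimal : IsMinimalLeftIdeal (principalLeft A))
               (k : Fin n) (a≉0 : ¬ (A k ≈ᵥ (λ _ → 0#)))
               {B : Mat n} {F : Subset n} (Λ : ParametricForm B F) where
    open RankOne 𝕂A-minimal k a≉0

    v : Fin n → Mat n
    v i = B *ₘ C i a

    v≈outer : ∀ i → v i ≈ₘ outer (B *ᵥ e i) a
    v≈outer i = ≈ₘ-trans (*ₘ-congˡ B (C≈outer-e i a)) (*ₘ-outer B (e i) a)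

    v-entry : ∀ i r s → v i r s ≈ B r i * a s
    v-entry i r s = trans (v≈outer i r s) (*-congʳ (*ᵥ-e B i r))

    combination≈outer : ∀ (μ : Vector n) → ∑ₘ∉ F (λ i → μ i ·ₘ v i) ≈ₘ outer (B *ᵥ zeroOn F μ) a
    combination≈outer μ r s = begin
      ∑∉ F (λ i → μ i * v i r s)                ≈⟨ ∑∉-* F μ (λ i → v i r s) ⟩
      ∑ (λ i → zeroOn F μ i * v i r s)          ≈⟨ ∑-cong (λ i → *-congˡ (v-entry i r s)) ⟩
      ∑ (λ i → zeroOn F μ i * (B r i * a s))    ≈⟨ ∑-cong (λ i → x∙yz≈y∙xz (zeroOn F μ i) (B r i) (a s)) ⟩
      ∑ (λ i → B r i * (zeroOn F μ i * a s))    ≈⟨ ∑-cong (λ i → *-assoc (B r i) (zeroOn F μ i) (a s)) ⟨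
      ∑ (λ i → B r i * zeroOn F μ i * a s)      ≈⟨ *-distribʳ-∑ (a s) (λ i → B r i * zeroOn F μ i) ⟨
      (B *ᵥ zeroOn F μ) r * a s                 ∎
      where open ≈-Reasoning

    v∈B𝕂A : ∀ i → leftRight B A (v i)
    v∈B𝕂A i = outer (e i) (e k) , (begin
      v i                                   ≈⟨ v≈outer i ⟩
      outer (B *ᵥ e i) a                    ≈⟨ *ₘ-outer B (e i) a ⟨
      B *ₘ outer (e i) a                    ≈⟨ *ₘ-congˡ B (outer-e-*ₘ (e i) k A) ⟨
      B *ₘ (outer (e i) (e k) *ₘ A)         ≈⟨ *ₘ-assoc B (outer (e i) (e k)) A ⟨
      (B *ₘ outer (e i) (e k)) *ₘ A         ∎)
      where open ≈ₘ-Reasoning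

    B𝕂A≈outer : ∀ {X} → leftRight B A X → ∃ λ (x : Vector n) → X ≈ₘ outer (B *ᵥ x) a
    B𝕂A≈outer {X} (M , X≈BMA) = M *ᵥ ρ , (begin
      X                          ≈⟨ X≈BMA ⟩
      (B *ₘ M) *ₘ A              ≈⟨ *ₘ-assoc B M A ⟩
      B *ₘ (M *ₘ A)              ≈⟨ *ₘ-congˡ B (*ₘ-congˡ M A≈outer-ρ-a) ⟩
      B *ₘ (M *ₘ outer ρ a)      ≈⟨ *ₘ-congˡ B (*ₘ-outer M ρ a) ⟩
      B *ₘ outer (M *ᵥ ρ) a      ≈⟨ *ₘ-outer B (M *ᵥ ρ) a ⟩
      outer (B *ᵥ (M *ᵥ ρ)) a    ∎)
      where open ≈ₘ-Reasoning

    spanning : ∀ X → leftRight B A X → ∃ λ (μ : Vector n) → X ≈ₘ ∑ₘ∉ F (λ i → μ i ·ₘ v i)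
    spanning X X∈B𝕂A with B𝕂A≈outer X∈B𝕂A
    ... | x , X≈outer with columns∉-span Λ x
    ... | μ , Bx≈Bμ = μ , (begin
      X                             ≈⟨ X≈outer ⟩
      outer (B *ᵥ x) a              ≈⟨ outer-congˡ a Bx≈Bμ ⟩
      outer (B *ᵥ zeroOn F μ) a     ≈⟨ combination≈outer μ ⟨
      ∑ₘ∉ F (λ i → μ i ·ₘ v i)      ∎)
      where open ≈ₘ-Reasoning

    independent : ∀ (μ : Vector n) → ∑ₘ∉ F (λ i → μ i ·ₘ v i) ≈ₘ 0ₘ → ∀ i → i ∉ F → μ i ≈ 0#
    independent μ combination≈0 i i∉F = begin
      μ i          ≡⟨ zeroOn-∉ μ i∉F ⟨
      zeroOn F μ i ≈⟨ solution-vanishing-on-F⇒zero Λ solution vanishing i ⟩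
      0#           ∎
      where
        open ≈-Reasoning
        solution : IsSolution B (zeroOn F μ)
        solution r = cancel-a (λ s → trans (sym (combination≈outer μ r s)) (combination≈0 r s))
        vanishing : ∀ j → j ∈ F → zeroOn F μ j ≈ 0#
        vanishing j j∈F = reflexive (zeroOn-∈ μ j∈F)

proposition5p1 : ∀ {c ℓ : Level} (K : Field c ℓ) → let open LinAlg K in
    (n : ℕ) → 1 ≤ n →
    (A : Mat n) → ¬ (A ≈ₘ 0ₘ) → IsMinimalLeftIdeal (principalLeft A) →
    (B : Mat n) → ¬ (B ≈ₘ 0ₘ) →
    (k : Fin n) → ¬ (A k ≈ᵥ (λ _ → 0#)) →
    (F : Subset n) → ParametricForm B F →
    IsBasis∉ (leftRight B A) F (λ i → B *ₘ C i (A k))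
-- 1 ≤ n and A ≉ 0 follow from the nonzero row k.
proposition5p1 K n _ A _ 𝕂A-minimal B _ k a≉0 F Λ = record
  { members     = λ i _ → v∈B𝕂A i
  ; spanning    = spanning
  ; independent = independent
  }
  where open Basis K 𝕂A-minimal k a≉0 Λ
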